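{- For every integer $n \geq 8$, $h(n,5) \leq \frac{7n + c(n \bmod 6)}{6}$, where $c(0)=0$, $c(1)=35$, $c(2)=16$, $c(3)=27$, $c(4)=8$, $c(5)=28$.
   Context: All graphs are finite and simple. A degree monotone path in a graph $G$ is a path $v_1v_2\ldots v_m$ such that $\deg(v_1)\le\cdots\le\deg(v_m)$ or $\deg(v_1)\ge\cdots\ge\deg(v_m)$, where degrees are taken in $G$. Its length is its number of vertices $m$. $mp(G)$ denotes the maximum length of a degree monotone path in $G$. For $k\ge 2$, a graph $G$ is called $k$-saturated if $mp(G)<k$ and $mp(G+e)\ge k$ for every edge $e$ joining two nonadjacent vertices of $G$, where $G+e$ is $G$ with $e$ added. In particular, every complete graph $K_m$ with $m\le k-1$ is $k$-saturated. $h(n,k)$ is the minimum number of edges of a $k$-saturated graph on $n$ vertices. -}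

module Defs where

open import Data.Nat using (ℕ; zero; suc; _+_; _≤_; _<_; _≥_)
open import Data.Bool using (Bool; true; false; _∨_; _∧_; if_then_else_)
open import Data.Fin using (Fin; toℕ; _≟_)
open import Data.Fin.Properties using ()
open import Data.List using (List; []; _∷_; map; length; allFin)
open import Data.Nat.ListAction using (sum)
open import Data.List.Relation.Unary.Unique.Propositional using (Unique)
open import Data.List.Relation.Unary.Linked using (Linked)
open import Data.Product using (_×_; Σ; ∃)
open import Data.Sum using (_⊎_)
open import Relation.Binary.PropositionalEquality using (_≡_; _≢_)
open import Relation.Nullary.Decidable using (⌊_⌋)
import Data.Nat as ℕ

AdjFn : ℕ → Set
AdjFn n = Fin n → Fin n → Bool

IsSimple : ∀ {n} → AdjFn n → Set
IsSimple {n} A = (∀ i j → A i j ≡ A j i) × (∀ i → A i i ≡ false)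

Adj : ∀ {n} → AdjFn n → Fin n → Fin n → Set
Adj A i j = A i j ≡ true

b2n : Bool → ℕ
b2n true = 1
b2n false = 0

deg : ∀ {n} → AdjFn n → Fin n → ℕ
deg {n} A i = sum (map (λ j → b2n (A i j)) (allFin n))

numEdges : ∀ {n} → AdjFn n → ℕ
numEdges {n} A =
  sum (map (λ i → sum (map (λ j → b2n (A i j ∧ (toℕ i ℕ.<ᵇ toℕ j))) (allFin n))) (allFin n))

IsPath : ∀ {n} → AdjFn n → List (Fin n) → Set
IsPath A p = Unique p × Linked (Adj A) p

DegMonotone : ∀ {n} → AdjFn n → List (Fin n) → Set
DegMonotone A p = Linked _≤_ (map (deg A) p) ⊎ Linked _≥_ (map (deg A) p)

IsDMP : ∀ {n} → AdjFn n → List (Fin n) → Set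
IsDMP A p = IsPath A p × DegMonotone A p

MpLess : ∀ {n} → AdjFn n → ℕ → Set
MpLess {n} A k = (p : List (Fin n)) → IsDMP A p → length p < k

MpAtLeast : ∀ {n} → AdjFn n → ℕ → Set
MpAtLeast {n} A k = Σ (List (Fin n)) λ p → IsDMP A p × k ≤ length p

addEdge : ∀ {n} → AdjFn n → Fin n → Fin n → AdjFn n
addEdge A u v i j =
  A i j ∨ ((⌊ i ≟ u ⌋ ∧ ⌊ j ≟ v ⌋) ∨ (⌊ i ≟ v ⌋ ∧ ⌊ j ≟ u ⌋))

Saturated : ∀ {n} → AdjFn n → ℕ → Set
Saturated {n} A k =
  MpLess A k ×
  ((u v : Fin n) → u ≢ v → A u v ≡ false → MpAtLeast (addEdge A u v) k)

c : ℕ → ℕ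
c 0 = 0
c 1 = 35
c 2 = 16
c 3 = 27
c 4 = 8
c 5 = 28
c _ = 0

-- The graph is a disjoint union of small "pieces": θ (a 6-cycle 0-2-4-1-5-3-0
-- with the chord 0-1; 6 vertices, 7 edges), K₄ and K₅⁻ (K₅ minus an edge).
-- Padding a base list, chosen according to n mod 6, with copies of θ gives
-- exactly n vertices and the required number of edges.
--
-- Saturation of the whole graph follows because every missing edge lives in
-- a piece or between two pieces, both of which embed into the whole graph.

module Submission where

open import Defs
open import Data.Nat using (ℕ; zero; suc; _+_; _*_; _%_; _/_; _≤_; _≥_; _<_; _≤?_; _≥?_; _<ᵇ_; _≤ᵇ_)
open import Data.Nat.Properties
  using (+-assoc; +-identityʳ; *-distribˡ-+; +-monoˡ-≤; ≤⇒≤ᵇ; ≤ᵇ⇒≤; <ᵇ⇒<; +-commutativeSemigroup)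
open import Data.Nat.DivMod using (m≡m%n+[m/n]*n; [m+kn]%n≡m%n; m%n<n)
open import Data.Nat.ListAction using (sum)
open import Data.Nat.Solver using (module +-*-Solver)
open import Algebra.Properties.CommutativeSemigroup +-commutativeSemigroup using (interchange)
open import Data.Bool as Bool using (Bool; true; false; _∧_; _∨_; not)
open import Data.Bool.Properties using (∨-comm; ¬-not)
open import Data.Empty using (⊥-elim)
open import Data.Fin using (Fin; zero; suc; toℕ; splitAt; _↑ˡ_; _↑ʳ_; _≟_)
open import Data.Fin.Properties using (suc-injective; splitAt-↑ˡ; splitAt-↑ʳ; ↑ˡ-injective; ↑ʳ-injective; toℕ-↑ˡ; toℕ-↑ʳ; all?)
open import Data.List using (List; []; _∷_; _++_; map; length; allFin; tabulate; replicate; filter; concatMap; take)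
open import Data.List.Properties using (map-tabulate; map-cong; map-∘; length-map; take-map)
open import Data.List.Relation.Unary.AllPairs using (allPairs?; [])
open import Data.List.Relation.Unary.Linked as Linked using (Linked; []; [-]; _∷_; linked?)
import Data.List.Relation.Unary.Linked.Properties as Linkedₚ
import Data.List.Relation.Unary.Unique.Propositional.Properties as Uniqueₚ
open import Data.Product using (_×_; _,_; Σ; proj₁; proj₂)
open import Data.Sum as Sum using (_⊎_; inj₁; inj₂; [_,_]′)
open import Data.Vec as Vec using (Vec; lookup)
open import Function using (id; _∘_)
open import Relation.Binary.PropositionalEquality
open import Relation.Nullary using (¬_; Dec; yes; no; contradiction)
open import Relation.Nullary.Decidable using (⌊_⌋; True; toWitness; T?; ¬?; _×-dec_; _⊎-dec_; _→-dec_)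
open ≡-Reasoning

sumAll : ∀ {n} → (Fin n → ℕ) → ℕ
sumAll {n} f = sum (map f (allFin n))

sumAll-suc : ∀ {n} (f : Fin (suc n) → ℕ) → sumAll f ≡ f zero + sumAll (f ∘ suc)
sumAll-suc {n} f = begin
  sum (map f (allFin (suc n)))       ≡⟨ cong sum (map-tabulate id f) ⟩
  f zero + sum (tabulate (f ∘ suc))  ≡⟨ cong (λ xs → f zero + sum xs) (sym (map-tabulate id (f ∘ suc))) ⟩
  f zero + sumAll (f ∘ suc)          ∎

sumAll-cong : ∀ {n} {f g : Fin n → ℕ} → (∀ i → f i ≡ g i) → sumAll f ≡ sumAll g
sumAll-cong {n} f≗g = cong sum (map-cong f≗g (allFin n))

sumAll-zero : ∀ {n} (f : Fin n → ℕ) → (∀ i → f i ≡ 0) → sumAll f ≡ 0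
sumAll-zero {zero} f _ = refl
sumAll-zero {suc n} f f≗0 =
  trans (sumAll-suc f) (cong₂ _+_ (f≗0 zero) (sumAll-zero (f ∘ suc) (f≗0 ∘ suc)))

sumAll-+ : ∀ {n} (f g : Fin n → ℕ) → sumAll (λ i → f i + g i) ≡ sumAll f + sumAll g
sumAll-+ {zero} f g = refl
sumAll-+ {suc n} f g = begin
  sumAll (λ i → f i + g i)                                   ≡⟨ sumAll-suc (λ i → f i + g i) ⟩
  (f zero + g zero) + sumAll (λ i → f (suc i) + g (suc i))   ≡⟨ cong (f zero + g zero +_) (sumAll-+ (f ∘ suc) (g ∘ suc)) ⟩
  (f zero + g zero) + (sumAll (f ∘ suc) + sumAll (g ∘ suc))  ≡⟨ interchange (f zero) (g zero) _ _ ⟩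
  (f zero + sumAll (f ∘ suc)) + (g zero + sumAll (g ∘ suc))  ≡⟨ sym (cong₂ _+_ (sumAll-suc f) (sumAll-suc g)) ⟩
  sumAll f + sumAll g                                        ∎

sumAll-split : ∀ {m n} (f : Fin (m + n) → ℕ) →
  sumAll f ≡ sumAll (λ i → f (i ↑ˡ n)) + sumAll (λ j → f (m ↑ʳ j))
sumAll-split {zero} f = refl
sumAll-split {suc m} {n} f = begin
  sumAll f                                                   ≡⟨ sumAll-suc f ⟩
  f zero + sumAll (f ∘ suc)                                  ≡⟨ cong (f zero +_) (sumAll-split {m} (f ∘ suc)) ⟩
  f zero + (sumAll (λ i → f (suc (i ↑ˡ n))) + sumAll (λ j → f (suc m ↑ʳ j)))
                                                             ≡⟨ sym (+-assoc (f zero) _ _) ⟩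
  (f zero + sumAll (λ i → f (suc (i ↑ˡ n)))) + sumAll (λ j → f (suc m ↑ʳ j))
                                                             ≡⟨ cong (_+ sumAll (λ j → f (suc m ↑ʳ j))) (sym (sumAll-suc (λ i → f (i ↑ˡ n)))) ⟩
  sumAll (λ i → f (i ↑ˡ n)) + sumAll (λ j → f (suc m ↑ʳ j))  ∎

≟-injective : ∀ {m n} (f : Fin m → Fin n) → (∀ {i j} → f i ≡ f j → i ≡ j) →
  ∀ i j → ⌊ f i ≟ f j ⌋ ≡ ⌊ i ≟ j ⌋
≟-injective f inj i j with f i ≟ f j | i ≟ j
... | yes _ | yes _ = refl
... | yes fi≡fj | no i≢j = contradiction (inj fi≡fj) i≢j
... | no fi≢fj | yes refl = contradiction refl fi≢fj
... | no _ | no _ = refl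

sumAll-indicator : ∀ {n} (c : Bool) (v : Fin n) → sumAll (λ j → b2n (c ∧ ⌊ j ≟ v ⌋)) ≡ b2n c
sumAll-indicator false v = sumAll-zero (λ j → b2n (false ∧ ⌊ j ≟ v ⌋)) (λ _ → refl)
sumAll-indicator {suc n} true zero =
  trans (sumAll-suc {n} (λ j → b2n ⌊ j ≟ zero ⌋)) (cong suc (sumAll-zero {n} (λ j → b2n ⌊ suc j ≟ zero ⌋) (λ _ → refl)))
sumAll-indicator {suc n} true (suc v) = begin
  sumAll (λ j → b2n ⌊ j ≟ suc v ⌋)      ≡⟨ sumAll-suc {n} (λ j → b2n ⌊ j ≟ suc v ⌋) ⟩
  sumAll (λ j → b2n ⌊ suc j ≟ suc v ⌋)  ≡⟨ sumAll-cong (λ j → cong b2n (≟-injective suc suc-injective j v)) ⟩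
  sumAll (λ j → b2n ⌊ j ≟ v ⌋)          ≡⟨ sumAll-indicator true v ⟩
  1                                     ∎

b2n-∨ : ∀ x y → (y ≡ true → x ≡ false) → b2n (x ∨ y) ≡ b2n x + b2n y
b2n-∨ false y _ = refl
b2n-∨ true false _ = refl
b2n-∨ true true exclusive with exclusive refl
... | ()

∨-true : ∀ {x y} → x ∨ y ≡ true → x ≡ true ⊎ y ≡ true
∨-true {true} _ = inj₁ refl
∨-true {false} y≡true = inj₂ y≡true

≟-pair : ∀ {n} (a b c d : Fin n) → ⌊ a ≟ b ⌋ ∧ ⌊ c ≟ d ⌋ ≡ true → a ≡ b × c ≡ d
≟-pair a b c d holds with a ≟ b | c ≟ d
... | yes a≡b | yes c≡d = a≡b , c≡d
≟-pair a b c d () | yes _ | no _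
≟-pair a b c d () | no _ | _

deg-addEdge : ∀ {n} {A : AdjFn n} {u v : Fin n} → IsSimple A → u ≢ v → A u v ≡ false → ∀ w →
  deg (addEdge A u v) w ≡ deg A w + (b2n ⌊ w ≟ u ⌋ + b2n ⌊ w ≟ v ⌋)
deg-addEdge {n} {A} {u} {v} (symmetric , _) u≢v uv w = begin
  deg (addEdge A u v) w                                 ≡⟨ sumAll-cong entry ⟩
  sumAll (λ j → b2n (A w j) + (b2n (P j) + b2n (Q j)))  ≡⟨ sumAll-+ (b2n ∘ A w) _ ⟩
  deg A w + sumAll (λ j → b2n (P j) + b2n (Q j))        ≡⟨ cong (deg A w +_) (sumAll-+ (b2n ∘ P) (b2n ∘ Q)) ⟩
  deg A w + (sumAll (b2n ∘ P) + sumAll (b2n ∘ Q))       ≡⟨ cong (deg A w +_)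
                                                             (cong₂ _+_ (sumAll-indicator _ v) (sumAll-indicator _ u)) ⟩
  deg A w + (b2n ⌊ w ≟ u ⌋ + b2n ⌊ w ≟ v ⌋)             ∎
  where
  P Q : Fin n → Bool
  P j = ⌊ w ≟ u ⌋ ∧ ⌊ j ≟ v ⌋
  Q j = ⌊ w ≟ v ⌋ ∧ ⌊ j ≟ u ⌋
  -- the added entries are not edges of A, and they are distinct since u ≢ v
  new : ∀ j → P j ∨ Q j ≡ true → A w j ≡ false
  new j added with ∨-true {P j} added
  ... | inj₁ p with ≟-pair w u j v p
  ...   | refl , refl = uv
  new j added | inj₂ q with ≟-pair w v j u q
  ...   | refl , refl = trans (symmetric v u) uv
  distinct : ∀ j → Q j ≡ true → P j ≡ false
  distinct j q = ¬-not λ p → u≢v (trans (sym (proj₁ (≟-pair w u j v p))) (proj₁ (≟-pair w v j u q)))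
  entry : ∀ j → b2n (addEdge A u v w j) ≡ b2n (A w j) + (b2n (P j) + b2n (Q j))
  entry j = trans (b2n-∨ (A w j) (P j ∨ Q j) (new j)) (cong (b2n (A w j) +_) (b2n-∨ (P j) (Q j) (distinct j)))

-- Degree
-- monotone paths and their lengths transfer along such maps.
record Embedding {m n} (A : AdjFn m) (B : AdjFn n) : Set where
  field
    apply     : Fin m → Fin n
    injective : ∀ {i j} → apply i ≡ apply j → i ≡ j
    adjacency : ∀ i j → B (apply i) (apply j) ≡ A i j
    degree    : ∀ i → deg B (apply i) ≡ deg A i
open Embedding

idᴱ : ∀ {n} {A : AdjFn n} → Embedding A A
idᴱ = record { apply = id ; injective = id ; adjacency = λ _ _ → refl ; degree = λ _ → refl }

_∘ᴱ_ : ∀ {l m n} {A : AdjFn l} {B : AdjFn m} {C : AdjFn n} → Embedding B C → Embedding A B → Embedding A C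
g ∘ᴱ f = record
  { apply     = apply g ∘ apply f
  ; injective = injective f ∘ injective g
  ; adjacency = λ i j → trans (adjacency g (apply f i) (apply f j)) (adjacency f i j)
  ; degree    = λ i → trans (degree g (apply f i)) (degree f i)
  }

Monotone : List ℕ → Set
Monotone ds = Linked _≤_ ds ⊎ Linked _≥_ ds

module _ {m n} {A : AdjFn m} {B : AdjFn n} (f : Embedding A B) where

  embedding-simple : IsSimple B → IsSimple A
  embedding-simple (symmetric , loopless) =
      (λ i j → trans (sym (adjacency f i j)) (trans (symmetric _ _) (adjacency f j i)))
    , (λ i → trans (sym (adjacency f i i)) (loopless (apply f i)))

  map-degrees : ∀ p → map (deg B) (map (apply f) p) ≡ map (deg A) p
  map-degrees p = trans (sym (map-∘ p)) (map-cong (degree f) p)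

  push-DMP : ∀ {p} → IsDMP A p → IsDMP B (map (apply f) p)
  push-DMP {p} ((unique , linked) , monotone) =
      ( Uniqueₚ.map⁺ (injective f) unique
      , Linkedₚ.map⁺ (Linked.map (λ {i} {j} adj → trans (adjacency f i j) adj) linked))
    , subst Monotone (sym (map-degrees p)) monotone

  pull-DMP : ∀ {p} → IsDMP B (map (apply f) p) → IsDMP A p
  pull-DMP {p} ((unique , linked) , monotone) =
      ( Uniqueₚ.map⁻ unique
      , Linked.map (λ {i} {j} adj → trans (sym (adjacency f i j)) adj) (Linkedₚ.map⁻ linked))
    , subst Monotone (map-degrees p) monotone

  push-mpAtLeast : ∀ {k} → MpAtLeast A k → MpAtLeast B k
  push-mpAtLeast (p , dmp , long) =
    map (apply f) p , push-DMP dmp , subst (_ ≤_) (sym (length-map (apply f) p)) long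

  extend : IsSimple B → ∀ {u v} → u ≢ v → A u v ≡ false →
    Embedding (addEdge A u v) (addEdge B (apply f u) (apply f v))
  extend simpleB {u} {v} u≢v uv = record
    { apply     = apply f
    ; injective = injective f
    ; adjacency = λ i j → cong₂ _∨_ (adjacency f i j)
                   (cong₂ _∨_ (cong₂ _∧_ (same i u) (same j v)) (cong₂ _∧_ (same i v) (same j u)))
    ; degree    = degree′
    }
    where
    same : ∀ i j → ⌊ apply f i ≟ apply f j ⌋ ≡ ⌊ i ≟ j ⌋
    same = ≟-injective (apply f) (injective f)
    degree′ : ∀ i → deg (addEdge B (apply f u) (apply f v)) (apply f i) ≡ deg (addEdge A u v) i
    degree′ i = begin
      deg (addEdge B (apply f u) (apply f v)) (apply f i)
        ≡⟨ deg-addEdge simpleB (u≢v ∘ injective f) (trans (adjacency f u v) uv) (apply f i) ⟩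
      deg B (apply f i) + (b2n ⌊ apply f i ≟ apply f u ⌋ + b2n ⌊ apply f i ≟ apply f v ⌋)
        ≡⟨ cong₂ _+_ (degree f i) (cong₂ _+_ (cong b2n (same i u)) (cong b2n (same i v))) ⟩
      deg A i + (b2n ⌊ i ≟ u ⌋ + b2n ⌊ i ≟ v ⌋)
        ≡⟨ sym (deg-addEdge (embedding-simple simpleB) u≢v uv i) ⟩
      deg (addEdge A u v) i ∎

  -- The image is closed under adjacency, i.e. a union of components of B.
  Closed : Set
  Closed = ∀ a y → Adj B (apply f a) y → Σ (Fin m) λ b → apply f b ≡ y

  path-in-image : Closed → ∀ a p → Linked (Adj B) (apply f a ∷ p) → Σ (List (Fin m)) λ q → p ≡ map (apply f) q
  path-in-image closed a [] _ = [] , refl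
  path-in-image closed a (y ∷ p) (adj ∷ linked) with closed a y adj
  ... | b , refl with path-in-image closed b p linked
  ...   | q , refl = b ∷ q , refl

  pull-mpLess : Closed → ∀ {k} → MpLess A k → ∀ a p → IsDMP B (apply f a ∷ p) → length (apply f a ∷ p) < k
  pull-mpLess closed {k} mpA a p dmp with path-in-image closed a p (proj₂ (proj₁ dmp))
  ... | q , refl = subst (_< k) (cong suc (sym (length-map (apply f) q))) (mpA (a ∷ q) (pull-DMP dmp))

Saturating : ∀ {n} → AdjFn n → ℕ → Set
Saturating {n} A k = (u v : Fin n) → u ≢ v → A u v ≡ false → MpAtLeast (addEdge A u v) k

unionAdj : ∀ {m n} → AdjFn m → AdjFn n → Fin m ⊎ Fin n → Fin m ⊎ Fin n → Bool
unionAdj A B (inj₁ i) (inj₁ j) = A i j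
unionAdj A B (inj₂ i) (inj₂ j) = B i j
unionAdj A B _ _ = false

union : ∀ {m n} → AdjFn m → AdjFn n → AdjFn (m + n)
union {m} A B i j = unionAdj A B (splitAt m i) (splitAt m j)

data Side (m n : ℕ) : Fin (m + n) → Set where
  left  : (i : Fin m) → Side m n (i ↑ˡ n)
  right : (j : Fin n) → Side m n (m ↑ʳ j)

side : ∀ m n (x : Fin (m + n)) → Side m n x
side zero n x = right x
side (suc m) n zero = left zero
side (suc m) n (suc x) with side m n x
... | left i = left (suc i)
... | right j = right j

module _ {m n} (A : AdjFn m) (B : AdjFn n) where

  union-ll : ∀ i j → union A B (i ↑ˡ n) (j ↑ˡ n) ≡ A i j
  union-ll i j rewrite splitAt-↑ˡ m i n | splitAt-↑ˡ m j n = refl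

  union-rr : ∀ i j → union A B (m ↑ʳ i) (m ↑ʳ j) ≡ B i j
  union-rr i j rewrite splitAt-↑ʳ m n i | splitAt-↑ʳ m n j = refl

  union-lr : ∀ i j → union A B (i ↑ˡ n) (m ↑ʳ j) ≡ false
  union-lr i j rewrite splitAt-↑ˡ m i n | splitAt-↑ʳ m n j = refl

  union-rl : ∀ i j → union A B (m ↑ʳ i) (j ↑ˡ n) ≡ false
  union-rl i j rewrite splitAt-↑ʳ m n i | splitAt-↑ˡ m j n = refl

  union-simple : IsSimple A → IsSimple B → IsSimple (union A B)
  union-simple (symA , looplessA) (symB , looplessB) = symmetric , loopless
    where
    symmetric : ∀ x y → union A B x y ≡ union A B y x
    symmetric x y with side m n x | side m n y
    ... | left i  | left j  = trans (union-ll i j) (trans (symA i j) (sym (union-ll j i)))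
    ... | left i  | right j = trans (union-lr i j) (sym (union-rl j i))
    ... | right i | left j  = trans (union-rl i j) (sym (union-lr j i))
    ... | right i | right j = trans (union-rr i j) (trans (symB i j) (sym (union-rr j i)))
    loopless : ∀ x → union A B x x ≡ false
    loopless x with side m n x
    ... | left i  = trans (union-ll i i) (looplessA i)
    ... | right j = trans (union-rr j j) (looplessB j)

  deg-union-left : ∀ i → deg (union A B) (i ↑ˡ n) ≡ deg A i
  deg-union-left i = begin
    deg (union A B) (i ↑ˡ n)
      ≡⟨ sumAll-split {m} {n} _ ⟩
    sumAll (λ j → b2n (union A B (i ↑ˡ n) (j ↑ˡ n))) + sumAll (λ j → b2n (union A B (i ↑ˡ n) (m ↑ʳ j)))
      ≡⟨ cong₂ _+_ (sumAll-cong (λ j → cong b2n (union-ll i j))) (sumAll-zero _ (λ j → cong b2n (union-lr i j))) ⟩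
    deg A i + 0
      ≡⟨ +-identityʳ _ ⟩
    deg A i ∎

  deg-union-right : ∀ j → deg (union A B) (m ↑ʳ j) ≡ deg B j
  deg-union-right j = begin
    deg (union A B) (m ↑ʳ j)
      ≡⟨ sumAll-split {m} {n} _ ⟩
    sumAll (λ i → b2n (union A B (m ↑ʳ j) (i ↑ˡ n))) + sumAll (λ i → b2n (union A B (m ↑ʳ j) (m ↑ʳ i)))
      ≡⟨ cong₂ _+_ (sumAll-zero _ (λ i → cong b2n (union-rl j i))) (sumAll-cong (λ i → cong b2n (union-rr j i))) ⟩
    deg B j ∎

  inl : Embedding A (union A B)
  inl = record { apply = _↑ˡ n ; injective = ↑ˡ-injective n _ _ ; adjacency = union-ll ; degree = deg-union-left }

  inr : Embedding B (union A B)
  inr = record { apply = m ↑ʳ_ ; injective = ↑ʳ-injective m _ _ ; adjacency = union-rr ; degree = deg-union-right }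

  inl-closed : Closed inl
  inl-closed i y adj with side m n y
  ... | left j  = j , refl
  ... | right j = contradiction (trans (sym (union-lr i j)) adj) λ ()

  inr-closed : Closed inr
  inr-closed i y adj with side m n y
  ... | left j  = contradiction (trans (sym (union-rl i j)) adj) λ ()
  ... | right j = j , refl

  -- A degree monotone path of A ∪ B lies in A or in B.
  union-mpLess : ∀ {k} → MpLess A k → MpLess B k → MpLess (union A B) k
  union-mpLess mpA mpB [] dmp = mpA [] ((([] , []) , inj₁ []))
  union-mpLess mpA mpB (x ∷ p) dmp with side m n x
  ... | left i  = pull-mpLess inl inl-closed mpA i p dmp
  ... | right j = pull-mpLess inr inr-closed mpB j p dmp

+-<ᵇ : ∀ m a b → (m + a <ᵇ m + b) ≡ (a <ᵇ b)
+-<ᵇ zero a b = refl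
+-<ᵇ (suc m) a b = +-<ᵇ m a b

numEdges-union : ∀ {m n} (A : AdjFn m) (B : AdjFn n) → numEdges (union A B) ≡ numEdges A + numEdges B
numEdges-union {m} {n} A B = trans (sumAll-split {m} {n} (row (union A B))) (cong₂ _+_ (sumAll-cong row-left) (sumAll-cong row-right))
  where
  row : ∀ {k} → AdjFn k → Fin k → ℕ
  row C i = sumAll (λ j → b2n (C i j ∧ (toℕ i <ᵇ toℕ j)))
  row-left : ∀ i → row (union A B) (i ↑ˡ n) ≡ row A i
  row-left i = begin
    row (union A B) (i ↑ˡ n)
      ≡⟨ sumAll-split {m} {n} _ ⟩
    sumAll (λ j → b2n (union A B (i ↑ˡ n) (j ↑ˡ n) ∧ (toℕ (i ↑ˡ n) <ᵇ toℕ (j ↑ˡ n))))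
      + sumAll (λ j → b2n (union A B (i ↑ˡ n) (m ↑ʳ j) ∧ (toℕ (i ↑ˡ n) <ᵇ toℕ (m ↑ʳ j))))
      ≡⟨ cong₂ _+_
           (sumAll-cong λ j → cong b2n (cong₂ _∧_ (union-ll A B i j) (cong₂ _<ᵇ_ (toℕ-↑ˡ i n) (toℕ-↑ˡ j n))))
           (sumAll-zero _ λ j → cong (λ e → b2n (e ∧ _)) (union-lr A B i j)) ⟩
    row A i + 0
      ≡⟨ +-identityʳ _ ⟩
    row A i ∎
  row-right : ∀ i → row (union A B) (m ↑ʳ i) ≡ row B i
  row-right i = begin
    row (union A B) (m ↑ʳ i)
      ≡⟨ sumAll-split {m} {n} _ ⟩
    sumAll (λ j → b2n (union A B (m ↑ʳ i) (j ↑ˡ n) ∧ (toℕ (m ↑ʳ i) <ᵇ toℕ (j ↑ˡ n))))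
      + sumAll (λ j → b2n (union A B (m ↑ʳ i) (m ↑ʳ j) ∧ (toℕ (m ↑ʳ i) <ᵇ toℕ (m ↑ʳ j))))
      ≡⟨ cong₂ _+_
           (sumAll-zero _ λ j → cong (λ e → b2n (e ∧ _)) (union-rl A B i j))
           (sumAll-cong λ j → cong b2n (cong₂ _∧_ (union-rr A B i j)
              (trans (cong₂ _<ᵇ_ (toℕ-↑ʳ m i) (toℕ-↑ʳ m j)) (+-<ᵇ m (toℕ i) (toℕ j))))) ⟩
    row B i ∎

↑ˡ≢↑ʳ : ∀ {m n} (i : Fin m) (j : Fin n) → i ↑ˡ n ≢ m ↑ʳ j
↑ˡ≢↑ʳ {m} {n} i j eq with trans (sym (splitAt-↑ˡ m i n)) (trans (cong (splitAt m) eq) (splitAt-↑ʳ m n j))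
... | ()

module _ {m n m′ n′} {A : AdjFn m} {B : AdjFn n} {C : AdjFn m′} {D : AdjFn n′}
         (f : Embedding A C) (g : Embedding B D) where

  ⊕-apply : Fin (m + n) → Fin (m′ + n′)
  ⊕-apply x = [ (λ a → apply f a ↑ˡ n′) , (λ b → m′ ↑ʳ apply g b) ]′ (splitAt m x)

  ⊕-left : ∀ a → ⊕-apply (a ↑ˡ n) ≡ apply f a ↑ˡ n′
  ⊕-left a = cong [ _ , _ ]′ (splitAt-↑ˡ m a n)

  ⊕-right : ∀ b → ⊕-apply (m ↑ʳ b) ≡ m′ ↑ʳ apply g b
  ⊕-right b = cong [ _ , _ ]′ (splitAt-↑ʳ m n b)

  _⊕_ : Embedding (union A B) (union C D)
  _⊕_ = record { apply = ⊕-apply ; injective = injective′ ; adjacency = adjacency′ ; degree = degree′ }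
    where
    injective′ : ∀ {x y} → ⊕-apply x ≡ ⊕-apply y → x ≡ y
    injective′ {x} {y} eq with side m n x | side m n y
    ... | left a  | left b  =
      cong (_↑ˡ n) (injective f (↑ˡ-injective n′ _ _ (trans (sym (⊕-left a)) (trans eq (⊕-left b)))))
    ... | left a  | right b = contradiction (trans (sym (⊕-left a)) (trans eq (⊕-right b))) (↑ˡ≢↑ʳ _ _)
    ... | right a | left b  = contradiction (trans (sym (⊕-left b)) (trans (sym eq) (⊕-right a))) (↑ˡ≢↑ʳ _ _)
    ... | right a | right b =
      cong (m ↑ʳ_) (injective g (↑ʳ-injective m′ _ _ (trans (sym (⊕-right a)) (trans eq (⊕-right b)))))
    adjacency′ : ∀ x y → union C D (⊕-apply x) (⊕-apply y) ≡ union A B x y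
    adjacency′ x y with side m n x | side m n y
    ... | left a  | left b  = trans (cong₂ (union C D) (⊕-left a) (⊕-left b))
                                (trans (union-ll C D _ _) (trans (adjacency f a b) (sym (union-ll A B a b))))
    ... | left a  | right b = trans (cong₂ (union C D) (⊕-left a) (⊕-right b))
                                (trans (union-lr C D _ _) (sym (union-lr A B a b)))
    ... | right a | left b  = trans (cong₂ (union C D) (⊕-right a) (⊕-left b))
                                (trans (union-rl C D _ _) (sym (union-rl A B a b)))
    ... | right a | right b = trans (cong₂ (union C D) (⊕-right a) (⊕-right b))
                                (trans (union-rr C D _ _) (trans (adjacency g a b) (sym (union-rr A B a b))))
    degree′ : ∀ x → deg (union C D) (⊕-apply x) ≡ deg (union A B) x
    degree′ x with side m n x
    ... | left a  = trans (cong (deg (union C D)) (⊕-left a))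
                      (trans (deg-union-left C D _) (trans (degree f a) (sym (deg-union-left A B a))))
    ... | right b = trans (cong (deg (union C D)) (⊕-right b))
                      (trans (deg-union-right C D _) (trans (degree g b) (sym (deg-union-right A B b))))

isDMP? : ∀ {n} (A : AdjFn n) (p : List (Fin n)) → Dec (IsDMP A p)
isDMP? A p = (allPairs? (λ x y → ¬? (x ≟ y)) p ×-dec linked? (λ x y → A x y Bool.≟ true) p)
       ×-dec (linked? _≤?_ (map (deg A) p) ⊎-dec linked? _≥?_ (map (deg A) p))

linked-take : ∀ {X : Set} {R : X → X → Set} {xs} k → Linked R xs → Linked R (take k xs)
linked-take zero _ = []
linked-take (suc k) [] = []
linked-take (suc zero) [-] = [-]
linked-take (suc (suc k)) [-] = [-]
linked-take (suc zero) (_ ∷ _) = [-]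
linked-take (suc (suc k)) (r ∷ rs) = r ∷ linked-take (suc k) rs

IsDMP-take : ∀ {n} {A : AdjFn n} {p} k → IsDMP A p → IsDMP A (take k p)
IsDMP-take {p = p} k ((unique , linked) , monotone) =
    (Uniqueₚ.take⁺ k unique , linked-take k linked)
  , subst Monotone (take-map k p) (Sum.map (linked-take k) (linked-take k) monotone)

NoDMP5 : ∀ {n} → AdjFn n → Set
NoDMP5 {n} A = ∀ a b c d e → ¬ IsDMP A (a ∷ b ∷ c ∷ d ∷ e ∷ [])

noDMP5? : ∀ {n} (A : AdjFn n) → Dec (NoDMP5 A)
noDMP5? A = all? λ a → all? λ b → all? λ c → all? λ d → all? λ e → ¬? (isDMP? A _)

mpLess-noDMP5 : ∀ {n} {A : AdjFn n} → NoDMP5 A → MpLess A 5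
mpLess-noDMP5 none (a ∷ b ∷ c ∷ d ∷ e ∷ p) dmp = ⊥-elim (none a b c d e (IsDMP-take 5 dmp))
mpLess-noDMP5 none [] _ = <ᵇ⇒< _ _ _
mpLess-noDMP5 none (_ ∷ []) _ = <ᵇ⇒< _ _ _
mpLess-noDMP5 none (_ ∷ _ ∷ []) _ = <ᵇ⇒< _ _ _
mpLess-noDMP5 none (_ ∷ _ ∷ _ ∷ []) _ = <ᵇ⇒< _ _ _
mpLess-noDMP5 none (_ ∷ _ ∷ _ ∷ _ ∷ []) _ = <ᵇ⇒< _ _ _

-- An untrusted search for a path on five vertices with non-decreasing degrees
-- (the reverse of a non-increasing one is such a path).  Its answers are
-- verified by isDMP?, so nothing is proved about the search itself.
module Search {n} (A : AdjFn n) (d : Fin n → ℕ) where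
  fresh : Fin n → List (Fin n) → Bool
  fresh x [] = true
  fresh x (y ∷ ys) = not ⌊ x ≟ y ⌋ ∧ fresh x ys

  grow : ℕ → Fin n → List (Fin n) → List (List (Fin n))
  grow zero x visited = (x ∷ []) ∷ []
  grow (suc k) x visited = map (x ∷_) (concatMap (λ y → grow k y (x ∷ visited))
    (filter (λ y → T? (A x y ∧ ((d x ≤ᵇ d y) ∧ fresh y (x ∷ visited)))) (allFin n)))

  firstPath : ℕ → List (Fin n)
  firstPath k with concatMap (λ x → grow k x []) (allFin n)
  ... | [] = []
  ... | p ∷ _ = p

-- The proposed path in A + uv; its degrees are tabulated once for the search.
candidate : ∀ {n} → AdjFn n → Fin n → Fin n → List (Fin n)
candidate {n} A u v = Search.firstPath (addEdge A u v) (lookup degrees) 4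
  where
  degrees : Vec ℕ n
  degrees = Vec.tabulate (deg (addEdge A u v))

Certified : ∀ {n} → AdjFn n → Fin n → Fin n → Set
Certified A u v = u ≢ v → A u v ≡ false →
  IsDMP (addEdge A u v) (candidate A u v) × 5 ≤ length (candidate A u v)

certified? : ∀ {n} (A : AdjFn n) → Dec (∀ u v → Certified A u v)
certified? A = all? λ u → all? λ v → ¬? (u ≟ v) →-dec (A u v Bool.≟ false) →-dec
  (isDMP? (addEdge A u v) (candidate A u v) ×-dec 5 ≤? length (candidate A u v))

saturating-by-search : ∀ {n} (A : AdjFn n) → True (certified? A) → Saturating A 5
saturating-by-search A ok u v u≢v uv =
  let (dmp , long) = toWitness ok u v u≢v uv in candidate A u v , dmp , long

data Piece : Set where
  θ K₄ K₅⁻ : Piece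

size : Piece → ℕ
size θ = 6
size K₄ = 4
size K₅⁻ = 5

arc : Piece → ℕ → ℕ → Bool
arc θ 0 1 = true
arc θ 0 2 = true
arc θ 0 3 = true
arc θ 1 4 = true
arc θ 1 5 = true
arc θ 2 4 = true
arc θ 3 5 = true
arc θ _ _ = false
arc K₄ i j = i <ᵇ j
arc K₅⁻ 3 4 = false
arc K₅⁻ i j = i <ᵇ j

piece : (t : Piece) → AdjFn (size t)
piece t i j = arc t (toℕ i) (toℕ j) ∨ arc t (toℕ j) (toℕ i)

piece-simple : ∀ t → IsSimple (piece t)
piece-simple t = (λ i j → ∨-comm (arc t (toℕ i) (toℕ j)) _) , loopless t
  where
  loopless : ∀ t (i : Fin (size t)) → piece t i i ≡ false
  loopless θ = toWitness {a? = all? λ i → piece θ i i Bool.≟ false} _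
  loopless K₄ = toWitness {a? = all? λ i → piece K₄ i i Bool.≟ false} _
  loopless K₅⁻ = toWitness {a? = all? λ i → piece K₅⁻ i i Bool.≟ false} _

piece-mpLess : ∀ t → MpLess (piece t) 5
piece-mpLess θ = mpLess-noDMP5 (toWitness {a? = noDMP5? (piece θ)} _)
piece-mpLess K₄ = mpLess-noDMP5 (toWitness {a? = noDMP5? (piece K₄)} _)
piece-mpLess K₅⁻ = mpLess-noDMP5 (toWitness {a? = noDMP5? (piece K₅⁻)} _)

piece-saturating : ∀ t → Saturating (piece t) 5
piece-saturating θ = saturating-by-search (piece θ) _
piece-saturating K₄ = saturating-by-search (piece K₄) _
piece-saturating K₅⁻ = saturating-by-search (piece K₅⁻) _

pair-saturating : ∀ t t′ → Saturating (union (piece t) (piece t′)) 5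
pair-saturating θ θ = saturating-by-search (union (piece θ) (piece θ)) _
pair-saturating θ K₄ = saturating-by-search (union (piece θ) (piece K₄)) _
pair-saturating θ K₅⁻ = saturating-by-search (union (piece θ) (piece K₅⁻)) _
pair-saturating K₄ θ = saturating-by-search (union (piece K₄) (piece θ)) _
pair-saturating K₄ K₄ = saturating-by-search (union (piece K₄) (piece K₄)) _
pair-saturating K₄ K₅⁻ = saturating-by-search (union (piece K₄) (piece K₅⁻)) _
pair-saturating K₅⁻ θ = saturating-by-search (union (piece K₅⁻) (piece θ)) _
pair-saturating K₅⁻ K₄ = saturating-by-search (union (piece K₅⁻) (piece K₄)) _
pair-saturating K₅⁻ K₅⁻ = saturating-by-search (union (piece K₅⁻) (piece K₅⁻)) _

order : List Piece → ℕ
order [] = 0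
order (t ∷ ts) = size t + order ts

edges : List Piece → ℕ
edges [] = 0
edges (t ∷ ts) = numEdges (piece t) + edges ts

layout : (ts : List Piece) → AdjFn (order ts)
layout [] ()
layout (t ∷ ts) = union (piece t) (layout ts)

layout-simple : ∀ ts → IsSimple (layout ts)
layout-simple [] = (λ ()) , (λ ())
layout-simple (t ∷ ts) = union-simple _ _ (piece-simple t) (layout-simple ts)

layout-mpLess : ∀ ts → MpLess (layout ts) 5
layout-mpLess [] [] _ = <ᵇ⇒< _ _ _
layout-mpLess [] (() ∷ _) _
layout-mpLess (t ∷ ts) = union-mpLess _ _ (piece-mpLess t) (layout-mpLess ts)

numEdges-layout : ∀ ts → numEdges (layout ts) ≡ edges ts
numEdges-layout [] = refl
numEdges-layout (t ∷ ts) = trans (numEdges-union (piece t) (layout ts)) (cong (numEdges (piece t) +_) (numEdges-layout ts))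

record InPiece (ts : List Piece) (x : Fin (order ts)) : Set where
  constructor inPiece
  field
    {kind} : Piece
    embed  : Embedding (piece kind) (layout ts)
    vertex : Fin (size kind)
    hits   : apply embed vertex ≡ x

locate : ∀ ts x → InPiece ts x
locate (t ∷ ts) x with side (size t) (order ts) x
... | left i  = inPiece (inl _ _) i refl
... | right j with locate ts j
...   | inPiece g b hits = inPiece (inr _ _ ∘ᴱ g) b (cong (size t ↑ʳ_) hits)

record LocalModel {n} (B : AdjFn n) (x y : Fin n) : Set where
  constructor localModel
  field
    {size′} : ℕ
    {model} : AdjFn size′
    saturating : Saturating model 5
    embed : Embedding model B
    u v : Fin size′
    hits-x : apply embed u ≡ x
    hits-y : apply embed v ≡ y

-- Adding the missing edge xy to B creates the path that adding uv creates in the model.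
local-saturation : ∀ {n} {B : AdjFn n} {x y} → IsSimple B → LocalModel B x y →
  x ≢ y → B x y ≡ false → MpAtLeast (addEdge B x y) 5
local-saturation simpleB (localModel {model = M} saturating f u v refl refl) x≢y xy =
  push-mpAtLeast (extend f simpleB u≢v uv) (saturating u v u≢v uv)
  where
  u≢v : u ≢ v
  u≢v = x≢y ∘ cong (apply f)
  uv : M u v ≡ false
  uv = trans (sym (adjacency f u v)) xy

-- Two vertices lie in one piece, or in two distinct pieces, of the layout.
local-model : ∀ ts x y → LocalModel (layout ts) x y
local-model (t ∷ ts) x y with side (size t) (order ts) x | side (size t) (order ts) y
... | left a   | left b   = localModel (piece-saturating t) (inl _ _) a b refl refl
... | left a   | right y′ with locate ts y′
...   | inPiece g b refl =
        localModel (pair-saturating t _) (idᴱ ⊕ g) (a ↑ˡ _) (size t ↑ʳ b)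
          (⊕-left (idᴱ {A = piece t}) g a) (⊕-right (idᴱ {A = piece t}) g b)
local-model (t ∷ ts) x y | right x′ | left b with locate ts x′
...   | inPiece g a refl =
        localModel (pair-saturating t _) (idᴱ ⊕ g) (size t ↑ʳ a) (b ↑ˡ _)
          (⊕-right (idᴱ {A = piece t}) g a) (⊕-left (idᴱ {A = piece t}) g b)
local-model (t ∷ ts) x y | right x′ | right y′ with local-model ts x′ y′
...   | localModel saturating f u v hx hy =
        localModel saturating (inr _ _ ∘ᴱ f) u v (cong (size t ↑ʳ_) hx) (cong (size t ↑ʳ_) hy)

layout-saturated : ∀ ts → Saturated (layout ts) 5
layout-saturated ts =
  layout-mpLess ts , λ x y x≢y xy → local-saturation (layout-simple ts) (local-model ts x y) x≢y xy

Bound : List Piece → Set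
Bound ts = 6 * edges ts ≤ 7 * order ts + c (order ts % 6)

SparseSaturated : ℕ → Set
SparseSaturated n = Σ (AdjFn n) λ A → IsSimple A × Saturated A 5 × 6 * numEdges A ≤ 7 * n + c (n % 6)

realise : ∀ ts → Bound ts → SparseSaturated (order ts)
realise ts bound =
    layout ts , layout-simple ts , layout-saturated ts
  , subst (λ e → 6 * e ≤ 7 * order ts + c (order ts % 6)) (sym (numEdges-layout ts)) bound

padded : ℕ → List Piece → List Piece
padded q ts = replicate q θ ++ ts

order-padded : ∀ q ts → order (padded q ts) ≡ order ts + q * 6
order-padded zero ts = sym (+-identityʳ _)
order-padded (suc q) ts = trans (cong (6 +_) (order-padded q ts)) (solve 2 (λ N Q → con 6 :+ (N :+ Q) := N :+ (con 6 :+ Q)) refl (order ts) (q * 6))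
  where open +-*-Solver

edges-padded : ∀ q ts → edges (padded q ts) ≡ edges ts + q * 7
edges-padded zero ts = sym (+-identityʳ _)
edges-padded (suc q) ts = trans (cong (7 +_) (edges-padded q ts)) (solve 2 (λ E Q → con 7 :+ (E :+ Q) := E :+ (con 7 :+ Q)) refl (edges ts) (q * 7))
  where open +-*-Solver

-- The edge bound survives padding, as 6 · 7q = 7 · 6q.
padded-bound : ∀ q ts → Bound ts → Bound (padded q ts)
padded-bound q ts bound = subst₂ _≤_ (sym edges-side) (sym order-side) (+-monoˡ-≤ (6 * (q * 7)) bound)
  where
  open +-*-Solver
  E N : ℕ
  E = edges ts
  N = order ts
  edges-side : 6 * edges (padded q ts) ≡ 6 * E + 6 * (q * 7)
  edges-side = trans (cong (6 *_) (edges-padded q ts)) (*-distribˡ-+ 6 E (q * 7))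
  order-side : 7 * order (padded q ts) + c (order (padded q ts) % 6) ≡ 7 * N + c (N % 6) + 6 * (q * 7)
  order-side = begin
    7 * order (padded q ts) + c (order (padded q ts) % 6) ≡⟨ cong (λ m → 7 * m + c (m % 6)) (order-padded q ts) ⟩
    7 * (N + q * 6) + c ((N + q * 6) % 6)                 ≡⟨ cong (λ r → 7 * (N + q * 6) + c r) ([m+kn]%n≡m%n N q 6) ⟩
    7 * (N + q * 6) + c (N % 6)                           ≡⟨ solve 3 (λ N Q C → con 7 :* (N :+ Q :* con 6) :+ C
                                                                          := con 7 :* N :+ C :+ con 6 :* (Q :* con 7))
                                                                       refl N q (c (N % 6)) ⟩
    7 * N + c (N % 6) + 6 * (q * 7)                       ∎

base : ℕ → List Piece
base 0 = []
base 1 = K₄ ∷ K₄ ∷ K₅⁻ ∷ []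
base 2 = K₄ ∷ K₄ ∷ []
base 3 = K₄ ∷ K₅⁻ ∷ []
base 4 = K₄ ∷ []
base _ = K₅⁻ ∷ []          -- residue 5

-- Checked by evaluation; e.g. base 1 has 13 vertices and 21 edges, and 6·21 = 7·13 + 35.
base-bound : ∀ r → Bound (base r)
base-bound 0 = ≤ᵇ⇒≤ _ _ _
base-bound 1 = ≤ᵇ⇒≤ _ _ _
base-bound 2 = ≤ᵇ⇒≤ _ _ _
base-bound 3 = ≤ᵇ⇒≤ _ _ _
base-bound 4 = ≤ᵇ⇒≤ _ _ _
base-bound (suc (suc (suc (suc (suc _))))) = ≤ᵇ⇒≤ _ _ _

residue-split : ∀ r k → r < 6 → 8 ≤ r + k * 6 → Σ ℕ λ q → order (base r) + q * 6 ≡ r + k * 6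
residue-split 0 k _ _ = k , refl
residue-split 1 (suc (suc k)) _ _ = k , refl
residue-split 1 0 _ small = ⊥-elim (≤⇒≤ᵇ small)
residue-split 1 1 _ small = ⊥-elim (≤⇒≤ᵇ small)
residue-split 2 (suc k) _ _ = k , refl
residue-split 2 0 _ small = ⊥-elim (≤⇒≤ᵇ small)
residue-split 3 (suc k) _ _ = k , refl
residue-split 3 0 _ small = ⊥-elim (≤⇒≤ᵇ small)
residue-split 4 k _ _ = k , refl
residue-split 5 k _ _ = k , refl
residue-split (suc (suc (suc (suc (suc (suc _)))))) _ r<6 _ = ⊥-elim (≤⇒≤ᵇ r<6)

decompose : ∀ n → 8 ≤ n → Σ ℕ λ q → order (padded q (base (n % 6))) ≡ n
decompose n 8≤n =
  let n≡ = m≡m%n+[m/n]*n n 6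
      (q , eq) = residue-split (n % 6) (n / 6) (m%n<n n 6) (subst (8 ≤_) n≡ 8≤n)
  in q , trans (order-padded q (base (n % 6))) (trans eq (sym n≡))

proposition2p8 : (n : ℕ) → 8 ≤ n →
    Σ (AdjFn n) λ A → IsSimple A × Saturated A 5 × 6 * numEdges A ≤ 7 * n + c (n % 6)
proposition2p8 n 8≤n =
  let (q , order≡n) = decompose n 8≤n
      r = n % 6
  in subst SparseSaturated order≡n (realise (padded q (base r)) (padded-bound q (base r) (base-bound r)))
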